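{- Let $G$ be a cycle on $n\ge 3$ vertices, let $S$ be a multiset of $n$ positive integers, and let $k$ be a positive integer. Then: (1) If $n\equiv 0 \pmod 4$, then $G$ is $S$-fair with $S$-fairness constant $k$ if and only if there exist $a,b\in\mathbb{N}$ with $a,b<k$ such that $S$ is the multiset consisting of $n/4$ copies of each of $a$, $b$, $k-a$, $k-b$. (2) If $n\not\equiv 0 \pmod 4$, then $G$ is $S$-fair with $S$-fairness constant $k$ if and only if $S$ consists of $n$ copies of $k/2$ (i.e., $k/2$ is the only element of $S$ and it occurs $n$ times).
   Context: For a finite simple undirected graph $G$ and a multiset $S$ of positive integers with $|S|=|V(G)|$, $G$ is called $S$-fair with $S$-fairness constant $k$ if there is a bijection $f$ from $V(G)$ to $S$ (each occurrence of an element of $S$ is assigned to exactly one vertex) such that for every vertex $v\in V(G)$, $\sum_{u\in N_G(v)} f(u)=k$, where $N_G(v)$ is the set of neighbours of $v$. -}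

module Defs where

open import Data.Nat using (ℕ; zero; suc; _+_; _%_; _≟_)
open import Data.Nat.ListAction using (sum)
open import Data.Bool using (Bool; if_then_else_; _∨_)
open import Data.Fin using (Fin; toℕ)
open import Data.List using (List; map; allFin)
open import Data.List.Relation.Binary.Permutation.Propositional using (_↭_)
open import Data.Product using (∃; _×_)
open import Relation.Binary.PropositionalEquality using (_≡_)
open import Relation.Nullary.Decidable using (⌊_⌋)

nbrSum : ∀ {n} → (Fin n → Fin n → Bool) → (Fin n → ℕ) → Fin n → ℕ
nbrSum {n} adj f v = sum (map (λ u → if adj v u then f u else 0) (allFin n))

-- G is S-fair with S-fairness constant k: there is a labelling f of the vertices
-- whose multiset of values is exactly S (i.e. a bijection V(G) → S respecting
-- multiplicities), such that every neighbourhood sum equals k.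
IsFair : ∀ {n} → (Fin n → Fin n → Bool) → List ℕ → ℕ → Set
IsFair {n} adj S k = ∃ λ (f : Fin n → ℕ) →
  (map f (allFin n) ↭ S) × (∀ v → nbrSum adj f v ≡ k)

cycleAdj : ∀ n → Fin n → Fin n → Bool
cycleAdj (suc m) i j =
  ⌊ (toℕ i + 1) % suc m ≟ toℕ j ⌋ ∨ ⌊ (toℕ j + 1) % suc m ≟ toℕ i ⌋

{-# OPTIONS --safe #-}
-- On the cycle the neighbours of vertex i + 1 are i and i + 2, so a fair labelling, unrolled to
-- an n-periodic function g on ℕ, satisfies g i + g (i + 2) = k for all i.  Applying this twice
-- gives g (i + 4) = g i, so g has the periods 4 and n.  If 4 ∣ n, g repeats the block
-- a, b, k − a, k − b with a = g 0, b = g 1 (positivity of the labels gives a, b < k).  If 4 ∤ n,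
-- then n mod 4 ∈ {1, 2, 3} is also a period, which forces period 2; then 2 g i = k for all i and
-- g is constant.  Conversely both kinds of labellings are fair.
module Submission where

open import Defs
open import Data.Nat using (ℕ; zero; suc; s≤s; _+_; _*_; _∸_; _<_; _≤_; _%_; _≟_; NonZero)
open import Data.Nat.Properties
open import Data.Nat.DivMod
open import Data.Nat.Divisibility using (_∣_; divides; ∣⇒≤)
open import Data.Nat.ListAction using (sum)
open import Data.Bool using (true; false; if_then_else_)
open import Data.Bool.Properties using (∨-zeroʳ)
open import Data.Fin using (Fin; zero; suc; toℕ)
open import Data.Fin.Properties using (toℕ-injective; toℕ<n; toℕ-fromℕ<)
import Data.Fin.Properties as Fin
open import Data.List using (List; []; _∷_; length; map; tabulate; allFin; replicate; applyUpTo; _++_; concat; concatMap)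
open import Data.List.Properties using (map-tabulate; ++-identityʳ)
open import Data.List.Relation.Unary.All using (All)
open import Data.List.Relation.Unary.All.Properties using (applyUpTo⁻)
open import Data.List.Relation.Binary.Permutation.Propositional using (_↭_; prep; ↭-refl; ↭-sym; ↭-trans; ↭-reflexive)
open import Data.List.Relation.Binary.Permutation.Propositional.Properties using (All-resp-↭; shifts; ++⁺ˡ)
open import Data.Product using (∃; ∃₂; _×_; _,_)
open import Data.Empty using (⊥-elim)
open import Function using (id; _∘_)
open import Function.Bundles using (_⇔_; mk⇔)
open import Function.Properties.Equivalence using () renaming (trans to ⇔-trans)
open import Relation.Nullary.Decidable using (⌊_⌋; isYes≗does; dec-true; dec-false)
open import Relation.Binary.PropositionalEquality
open ≡-Reasoning

sum-tabulate-zero : ∀ {n} (h : Fin n → ℕ) → (∀ u → h u ≡ 0) → sum (tabulate h) ≡ 0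
sum-tabulate-zero {zero}  h h≡0 = refl
sum-tabulate-zero {suc n} h h≡0 = cong₂ _+_ (h≡0 zero) (sum-tabulate-zero (h ∘ suc) (h≡0 ∘ suc))

sum-tabulate-single : ∀ {n} (h : Fin n → ℕ) w → (∀ u → u ≢ w → h u ≡ 0) → sum (tabulate h) ≡ h w
sum-tabulate-single {suc n} h zero h≡0 =
  trans (cong (h zero +_) (sum-tabulate-zero (h ∘ suc) (λ u → h≡0 (suc u) λ ()))) (+-identityʳ _)
sum-tabulate-single {suc n} h (suc w) h≡0 =
  cong₂ _+_ (h≡0 zero λ ()) (sum-tabulate-single (h ∘ suc) w (λ u u≢w → h≡0 (suc u) (u≢w ∘ Fin.suc-injective)))

sum-tabulate-pair : ∀ {n} (h : Fin n → ℕ) {w₁ w₂} → w₁ ≢ w₂ →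
  (∀ u → u ≢ w₁ → u ≢ w₂ → h u ≡ 0) → sum (tabulate h) ≡ h w₁ + h w₂
sum-tabulate-pair {suc n} h {zero} {zero} w₁≢w₂ _ = ⊥-elim (w₁≢w₂ refl)
sum-tabulate-pair {suc n} h {zero} {suc w₂} _ h≡0 =
  cong (h zero +_) (sum-tabulate-single (h ∘ suc) w₂ (λ u u≢w₂ → h≡0 (suc u) (λ ()) (u≢w₂ ∘ Fin.suc-injective)))
sum-tabulate-pair {suc n} h {suc w₁} {zero} _ h≡0 =
  trans (cong (h zero +_) (sum-tabulate-single (h ∘ suc) w₁ (λ u u≢w₁ → h≡0 (suc u) (u≢w₁ ∘ Fin.suc-injective) (λ ()))))
        (+-comm (h zero) _)
sum-tabulate-pair {suc n} h {suc w₁} {suc w₂} w₁≢w₂ h≡0 =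
  cong₂ _+_ (h≡0 zero (λ ()) (λ ()))
    (sum-tabulate-pair (h ∘ suc) (w₁≢w₂ ∘ cong suc)
      (λ u u≢w₁ u≢w₂ → h≡0 (suc u) (u≢w₁ ∘ Fin.suc-injective) (u≢w₂ ∘ Fin.suc-injective)))

[m%n+o]%n≡[m+o]%n : ∀ m o n .{{_ : NonZero n}} → (m % n + o) % n ≡ (m + o) % n
[m%n+o]%n≡[m+o]%n m o n = begin
  (m % n + o) % n          ≡⟨ %-distribˡ-+ (m % n) o n ⟩
  (m % n % n + o % n) % n  ≡⟨ cong (λ r → (r + o % n) % n) (m%n%n≡m%n m n) ⟩
  (m % n + o % n) % n      ≡⟨ %-distribˡ-+ m o n ⟨
  (m + o) % n              ∎

m%n≡o%n⇒n∣m∸o : ∀ m o n .{{_ : NonZero n}} → m % n ≡ o % n → n ∣ m ∸ o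
m%n≡o%n⇒n∣m∸o m o n eq = divides (m / n ∸ o / n) (begin
  m ∸ o                                    ≡⟨ cong₂ _∸_ (m≡m%n+[m/n]*n m n) (m≡m%n+[m/n]*n o n) ⟩
  (m % n + m / n * n) ∸ (o % n + o / n * n) ≡⟨ cong (λ r → (r + m / n * n) ∸ (o % n + o / n * n)) eq ⟩
  (o % n + m / n * n) ∸ (o % n + o / n * n) ≡⟨ [m+n]∸[m+o]≡n∸o (o % n) _ _ ⟩
  m / n * n ∸ o / n * n                    ≡⟨ *-distribʳ-∸ n (m / n) (o / n) ⟨
  (m / n ∸ o / n) * n                      ∎)

⌊≟⌋-true : ∀ {x y : ℕ} → x ≡ y → ⌊ x ≟ y ⌋ ≡ true
⌊≟⌋-true {x} {y} eq = trans (isYes≗does (x ≟ y)) (dec-true (x ≟ y) eq)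

⌊≟⌋-false : ∀ {x y : ℕ} → x ≢ y → ⌊ x ≟ y ⌋ ≡ false
⌊≟⌋-false {x} {y} x≢y = trans (isYes≗does (x ≟ y)) (dec-false (x ≟ y) x≢y)

toℕ-mod : ∀ i n .{{_ : NonZero n}} → toℕ (i mod n) ≡ i % n
toℕ-mod i n = toℕ-fromℕ< (m%n<n i n)

toℕ-%-id : ∀ {n} (v : Fin (suc n)) → toℕ v % suc n ≡ toℕ v
toℕ-%-id v = m<n⇒m%n≡m (toℕ<n v)

toℕ-mod-id : ∀ {n} (v : Fin (suc n)) → toℕ v mod suc n ≡ v
toℕ-mod-id {n} v = toℕ-injective (trans (toℕ-mod (toℕ v) (suc n)) (toℕ-%-id v))

mod-cong : ∀ i j n .{{_ : NonZero n}} → i % n ≡ j % n → i mod n ≡ j mod n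
mod-cong i j n eq = toℕ-injective (trans (toℕ-mod i n) (trans eq (sym (toℕ-mod j n))))

module _ (m : ℕ) where

  cycle-succ cycle-pred : Fin (suc m) → Fin (suc m)
  cycle-succ v = (toℕ v + 1) mod suc m
  cycle-pred v = (toℕ v + m) mod suc m

  [[x+1]%n+m]%n≡x%n : ∀ x → ((x + 1) % suc m + m) % suc m ≡ x % suc m
  [[x+1]%n+m]%n≡x%n x = begin
    ((x + 1) % suc m + m) % suc m ≡⟨ [m%n+o]%n≡[m+o]%n (x + 1) m (suc m) ⟩
    (x + 1 + m) % suc m           ≡⟨ %-congˡ (+-assoc x 1 m) ⟩
    (x + suc m) % suc m           ≡⟨ [m+n]%n≡m%n x (suc m) ⟩
    x % suc m                     ∎

  [[x+m]%n+1]%n≡x%n : ∀ x → ((x + m) % suc m + 1) % suc m ≡ x % suc m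
  [[x+m]%n+1]%n≡x%n x = begin
    ((x + m) % suc m + 1) % suc m ≡⟨ [m%n+o]%n≡[m+o]%n (x + m) 1 (suc m) ⟩
    (x + m + 1) % suc m           ≡⟨ %-congˡ (trans (+-assoc x m 1) (cong (x +_) (+-comm m 1))) ⟩
    (x + suc m) % suc m           ≡⟨ [m+n]%n≡m%n x (suc m) ⟩
    x % suc m                     ∎

  succ-adjacent : ∀ v → (toℕ v + 1) % suc m ≡ toℕ (cycle-succ v)
  succ-adjacent v = sym (toℕ-mod (toℕ v + 1) (suc m))

  pred-adjacent : ∀ v → (toℕ (cycle-pred v) + 1) % suc m ≡ toℕ v
  pred-adjacent v = begin
    (toℕ (cycle-pred v) + 1) % suc m   ≡⟨ cong (λ r → (r + 1) % suc m) (toℕ-mod (toℕ v + m) (suc m)) ⟩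
    ((toℕ v + m) % suc m + 1) % suc m  ≡⟨ [[x+m]%n+1]%n≡x%n (toℕ v) ⟩
    toℕ v % suc m                      ≡⟨ toℕ-%-id v ⟩
    toℕ v                              ∎

  succ-adjacent⁻ : ∀ v u → (toℕ v + 1) % suc m ≡ toℕ u → u ≡ cycle-succ v
  succ-adjacent⁻ v u eq = toℕ-injective (trans (sym eq) (succ-adjacent v))

  pred-adjacent⁻ : ∀ v u → (toℕ u + 1) % suc m ≡ toℕ v → u ≡ cycle-pred v
  pred-adjacent⁻ v u eq = toℕ-injective (begin
    toℕ u                             ≡⟨ toℕ-%-id u ⟨
    toℕ u % suc m                     ≡⟨ [[x+1]%n+m]%n≡x%n (toℕ u) ⟨
    ((toℕ u + 1) % suc m + m) % suc m ≡⟨ cong (λ r → (r + m) % suc m) eq ⟩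
    (toℕ v + m) % suc m               ≡⟨ toℕ-mod (toℕ v + m) (suc m) ⟨
    toℕ (cycle-pred v)                ∎)

  -- If pred v = succ v, two steps forward return to v, so the cycle length divides 2.
  pred≢succ : 2 ≤ m → ∀ v → cycle-pred v ≢ cycle-succ v
  pred≢succ 2≤m v pred≡succ = n≮n m (≤-trans (∣⇒≤ n∣2) 2≤m)
    where
    v+2≡v : (toℕ v + 2) % suc m ≡ toℕ v % suc m
    v+2≡v = begin
      (toℕ v + 2) % suc m                   ≡⟨ %-congˡ (+-assoc (toℕ v) 1 1) ⟨
      (toℕ v + 1 + 1) % suc m               ≡⟨ [m%n+o]%n≡[m+o]%n (toℕ v + 1) 1 (suc m) ⟨
      ((toℕ v + 1) % suc m + 1) % suc m     ≡⟨ cong (λ r → (r + 1) % suc m) (succ-adjacent v) ⟩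
      (toℕ (cycle-succ v) + 1) % suc m      ≡⟨ cong (λ w → (toℕ w + 1) % suc m) pred≡succ ⟨
      (toℕ (cycle-pred v) + 1) % suc m      ≡⟨ pred-adjacent v ⟩
      toℕ v                                 ≡⟨ toℕ-%-id v ⟨
      toℕ v % suc m                         ∎
    n∣2 : suc m ∣ 2
    n∣2 = subst (suc m ∣_) (m+n∸m≡n (toℕ v) 2) (m%n≡o%n⇒n∣m∸o (toℕ v + 2) (toℕ v) (suc m) v+2≡v)

  cycleAdj-succ : ∀ v → cycleAdj (suc m) v (cycle-succ v) ≡ true
  cycleAdj-succ v rewrite ⌊≟⌋-true (succ-adjacent v) = refl

  cycleAdj-pred : ∀ v → cycleAdj (suc m) v (cycle-pred v) ≡ true
  cycleAdj-pred v rewrite ⌊≟⌋-true (pred-adjacent v) = ∨-zeroʳ _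

  cycleAdj-other : ∀ v u → u ≢ cycle-pred v → u ≢ cycle-succ v → cycleAdj (suc m) v u ≡ false
  cycleAdj-other v u u≢pred u≢succ
    rewrite ⌊≟⌋-false (u≢succ ∘ succ-adjacent⁻ v u) | ⌊≟⌋-false (u≢pred ∘ pred-adjacent⁻ v u) = refl

  nbrSum-cycle : 2 ≤ m → ∀ f v → nbrSum (cycleAdj (suc m)) f v ≡ f (cycle-pred v) + f (cycle-succ v)
  nbrSum-cycle 2≤m f v = begin
    nbrSum (cycleAdj (suc m)) f v         ≡⟨ cong sum (map-tabulate id h) ⟩
    sum (tabulate h)                      ≡⟨ sum-tabulate-pair h (pred≢succ 2≤m v) h-other ⟩
    h (cycle-pred v) + h (cycle-succ v)   ≡⟨ cong₂ _+_ (at (cycleAdj-pred v)) (at (cycleAdj-succ v)) ⟩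
    f (cycle-pred v) + f (cycle-succ v)   ∎
    where
    h : Fin (suc m) → ℕ
    h u = if cycleAdj (suc m) v u then f u else 0
    at : ∀ {u} → cycleAdj (suc m) v u ≡ true → h u ≡ f u
    at adj = cong (if_then _ else 0) adj
    h-other : ∀ u → u ≢ cycle-pred v → u ≢ cycle-succ v → h u ≡ 0
    h-other u u≢pred u≢succ = cong (if_then f u else 0) (cycleAdj-other v u u≢pred u≢succ)

Periodic : ∀ {a} {A : Set a} → (ℕ → A) → ℕ → Set a
Periodic g p = ∀ i → g (i + p) ≡ g i

module _ {a} {A : Set a} {g : ℕ → A} where

  periodic-* : ∀ {p} → Periodic g p → ∀ q → Periodic g (q * p)
  periodic-* per zero    i = cong g (+-identityʳ i)
  periodic-* {p} per (suc q) i = begin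
    g (i + (p + q * p))  ≡⟨ cong g (+-assoc i p (q * p)) ⟨
    g (i + p + q * p)    ≡⟨ periodic-* per q (i + p) ⟩
    g (i + p)            ≡⟨ per i ⟩
    g i                  ∎

  periodic-∣ : ∀ {p n} → Periodic g p → p ∣ n → Periodic g n
  periodic-∣ per (divides q refl) = periodic-* per q

  periodic⇒g[i%p]≡g[i] : ∀ {p} .{{_ : NonZero p}} → Periodic g p → ∀ i → g (i % p) ≡ g i
  periodic⇒g[i%p]≡g[i] {p} per i = trans (sym (periodic-* per (i / p) (i % p))) (cong g (sym (m≡m%n+[m/n]*n i p)))

  periodic-% : ∀ {p n} .{{_ : NonZero p}} → Periodic g p → Periodic g n → Periodic g (n % p)
  periodic-% {p} {n} perₚ perₙ i = begin
    g (i + n % p)                ≡⟨ periodic-* perₚ (n / p) (i + n % p) ⟨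
    g (i + n % p + n / p * p)    ≡⟨ cong g (+-assoc i (n % p) (n / p * p)) ⟩
    g (i + (n % p + n / p * p))  ≡⟨ cong (g ∘ (i +_)) (m≡m%n+[m/n]*n n p) ⟨
    g (i + n)                    ≡⟨ perₙ i ⟩
    g i                          ∎

  periodic-2 : ∀ {n} → Periodic g 4 → Periodic g n → n % 4 ≢ 0 → Periodic g 2
  periodic-2 {n} per₄ perₙ n%4≢0 = from-residue (n % 4) (m%n<n n 4) n%4≢0 (periodic-% per₄ perₙ)
    where
    from-residue : ∀ r → r < 4 → r ≢ 0 → Periodic g r → Periodic g 2
    from-residue 0 _ r≢0 _ = ⊥-elim (r≢0 refl)
    from-residue 1 _ _ per₁ = periodic-* per₁ 2
    from-residue 2 _ _ per₂ = per₂
    from-residue 3 _ _ per₃ = periodic-* per₁ 2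
      where
      per₁ : Periodic g 1
      per₁ i = begin
        g (i + 1)      ≡⟨ per₃ (i + 1) ⟨
        g (i + 1 + 3)  ≡⟨ cong g (+-assoc i 1 3) ⟩
        g (i + 4)      ≡⟨ per₄ i ⟩
        g i            ∎
    from-residue (suc (suc (suc (suc _)))) (s≤s (s≤s (s≤s (s≤s ())))) _ _

  periodic-All : ∀ {p} {P : A → Set} .{{_ : NonZero p}} → Periodic g p → All P (applyUpTo g p) → ∀ i → P (g i)
  periodic-All {p} {P} per all i = subst P (periodic⇒g[i%p]≡g[i] per i) (applyUpTo⁻ g p all (m%n<n i p))

module _ {a} {A : Set a} where

  tabulate-toℕ : ∀ {n} (f : Fin n → A) (g : ℕ → A) → (∀ v → f v ≡ g (toℕ v)) → tabulate f ≡ applyUpTo g n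
  tabulate-toℕ {zero}  f g f≗g = refl
  tabulate-toℕ {suc n} f g f≗g = cong₂ _∷_ (f≗g zero) (tabulate-toℕ (f ∘ suc) (g ∘ suc) (f≗g ∘ suc))

  applyUpTo-cong : ∀ {f g : ℕ → A} → (∀ i → f i ≡ g i) → ∀ n → applyUpTo f n ≡ applyUpTo g n
  applyUpTo-cong f≗g zero    = refl
  applyUpTo-cong f≗g (suc n) = cong₂ _∷_ (f≗g 0) (applyUpTo-cong (f≗g ∘ suc) n)

  applyUpTo-const : ∀ {g : ℕ → A} {c} → (∀ i → g i ≡ c) → ∀ n → applyUpTo g n ≡ replicate n c
  applyUpTo-const g≗c zero    = refl
  applyUpTo-const g≗c (suc n) = cong₂ _∷_ (g≗c 0) (applyUpTo-const (g≗c ∘ suc) n)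

  applyUpTo-+ : ∀ (g : ℕ → A) m n → applyUpTo g (m + n) ≡ applyUpTo g m ++ applyUpTo (g ∘ (m +_)) n
  applyUpTo-+ g zero    n = refl
  applyUpTo-+ g (suc m) n = cong (g 0 ∷_) (applyUpTo-+ (g ∘ suc) m n)

  applyUpTo-periodic : ∀ {g : ℕ → A} {p} → Periodic g p → ∀ q →
    applyUpTo g (q * p) ≡ concat (replicate q (applyUpTo g p))
  applyUpTo-periodic per zero = refl
  applyUpTo-periodic {g} {p} per (suc q) = begin
    applyUpTo g (p + q * p)                               ≡⟨ applyUpTo-+ g p (q * p) ⟩
    applyUpTo g p ++ applyUpTo (g ∘ (p +_)) (q * p)       ≡⟨ cong (applyUpTo g p ++_) (applyUpTo-cong shift (q * p)) ⟩
    applyUpTo g p ++ applyUpTo g (q * p)                  ≡⟨ cong (applyUpTo g p ++_) (applyUpTo-periodic per q) ⟩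
    applyUpTo g p ++ concat (replicate q (applyUpTo g p)) ∎
    where
    shift : ∀ i → g (p + i) ≡ g i
    shift i = trans (cong g (+-comm p i)) (per i)

  concat-replicate-[] : ∀ q → concat {A = A} (replicate q []) ≡ []
  concat-replicate-[] zero    = refl
  concat-replicate-[] (suc q) = concat-replicate-[] q

  concat-replicate-∷ : ∀ q x (xs : List A) → concat (replicate q (x ∷ xs)) ↭ replicate q x ++ concat (replicate q xs)
  concat-replicate-∷ zero    x xs = ↭-refl
  concat-replicate-∷ (suc q) x xs = prep x (↭-trans
    (++⁺ˡ xs (concat-replicate-∷ q x xs))
    (shifts xs (replicate q x)))

  concat-replicate-↭ : ∀ q (xs : List A) → concat (replicate q xs) ↭ concatMap (replicate q) xs
  concat-replicate-↭ q []       = ↭-reflexive (concat-replicate-[] q)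
  concat-replicate-↭ q (x ∷ xs) = ↭-trans (concat-replicate-∷ q x xs) (++⁺ˡ (replicate q x) (concat-replicate-↭ q xs))

-- g i + g (i + 2) is the neighbour sum of the vertex i + 1 of the path 0 − 1 − 2 − ⋯ labelled by g.
PathFair : (ℕ → ℕ) → ℕ → Set
PathFair g k = ∀ i → g i + g (i + 2) ≡ k

module _ (g : ℕ → ℕ) {k : ℕ} (fair : PathFair g k) where

  pathFair-periodic : Periodic g 4
  pathFair-periodic i = +-cancelˡ-≡ (g (i + 2)) _ _ (begin
    g (i + 2) + g (i + 4)     ≡⟨ cong (λ j → g (i + 2) + g j) (+-assoc i 2 2) ⟨
    g (i + 2) + g (i + 2 + 2) ≡⟨ fair (i + 2) ⟩
    k                         ≡⟨ fair i ⟨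
    g i + g (i + 2)           ≡⟨ +-comm (g i) _ ⟩
    g (i + 2) + g i           ∎)

  pathFair-opposite : ∀ i → g (i + 2) ≡ k ∸ g i
  pathFair-opposite i = trans (sym (m+n∸m≡n (g i) _)) (cong (_∸ g i) (fair i))

  pathFair-< : ∀ i → 0 < g (i + 2) → g i < k
  pathFair-< i pos = subst (g i <_) (fair i) (m<m+n (g i) pos)

  pathFair-double : Periodic g 2 → ∀ i → g i + g i ≡ k
  pathFair-double per₂ i = trans (cong (g i +_) (sym (per₂ i))) (fair i)

  pathFair-constant : Periodic g 2 → ∀ i → g i ≡ g 0
  pathFair-constant per₂ i = *-cancelˡ-≡ (g i) (g 0) 2 (begin
    2 * g i      ≡⟨ cong (g i +_) (+-identityʳ (g i)) ⟩
    g i + g i    ≡⟨ trans (pathFair-double per₂ i) (sym (pathFair-double per₂ 0)) ⟩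
    g 0 + g 0    ≡⟨ cong (g 0 +_) (+-identityʳ (g 0)) ⟨
    2 * g 0      ∎)

alternating : ℕ → ℕ → ℕ → ℕ → ℕ
alternating a b k 0 = a
alternating a b k 1 = b
alternating a b k 2 = k ∸ a
alternating a b k 3 = k ∸ b
alternating a b k (suc (suc (suc (suc i)))) = alternating a b k i

alternating-periodic : ∀ a b k → Periodic (alternating a b k) 4
alternating-periodic a b k i = cong (alternating a b k) (+-comm i 4)

alternating-pathFair : ∀ {a b k} → a ≤ k → b ≤ k → PathFair (alternating a b k) k
alternating-pathFair a≤k b≤k 0 = m+[n∸m]≡n a≤k
alternating-pathFair a≤k b≤k 1 = m+[n∸m]≡n b≤k
alternating-pathFair a≤k b≤k 2 = m∸n+n≡m a≤k
alternating-pathFair a≤k b≤k 3 = m∸n+n≡m b≤k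
alternating-pathFair a≤k b≤k (suc (suc (suc (suc i)))) = alternating-pathFair a≤k b≤k i

-- A fair labelling of the cycle on n vertices, unrolled to a labelling of ℕ of period n.
PeriodicFair : ℕ → List ℕ → ℕ → Set
PeriodicFair n S k = ∃ λ g → Periodic g n × applyUpTo g n ↭ S × PathFair g k

module _ {m : ℕ} (2≤m : 2 ≤ m) {S : List ℕ} {k : ℕ} where

  isFair⇒periodicFair : IsFair (cycleAdj (suc m)) S k → PeriodicFair (suc m) S k
  isFair⇒periodicFair (f , perm , fair) = g , per , labels , pathFair
    where
    g : ℕ → ℕ
    g i = f (i mod suc m)
    per : Periodic g (suc m)
    per i = cong f (mod-cong (i + suc m) i (suc m) ([m+n]%n≡m%n i (suc m)))
    labels : applyUpTo g (suc m) ↭ S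
    labels = ↭-trans (↭-reflexive (sym (trans (map-tabulate id f)
               (tabulate-toℕ f g (λ v → cong f (sym (toℕ-mod-id v))))))) perm
    pathFair : PathFair g k
    pathFair i = begin
      g i + g (i + 2)                       ≡⟨ cong₂ (λ u w → f u + f w) pred≡ succ≡ ⟨
      f (cycle-pred m v) + f (cycle-succ m v) ≡⟨ nbrSum-cycle m 2≤m f v ⟨
      nbrSum (cycleAdj (suc m)) f v         ≡⟨ fair v ⟩
      k                                     ∎
      where
      v = (i + 1) mod suc m
      toℕ-v : toℕ v ≡ (i + 1) % suc m
      toℕ-v = toℕ-mod (i + 1) (suc m)
      pred≡ : cycle-pred m v ≡ i mod suc m
      pred≡ = mod-cong (toℕ v + m) i (suc m) (trans (cong (λ r → (r + m) % suc m) toℕ-v) ([[x+1]%n+m]%n≡x%n m i))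
      succ≡ : cycle-succ m v ≡ (i + 2) mod suc m
      succ≡ = mod-cong (toℕ v + 1) (i + 2) (suc m) (begin
        (toℕ v + 1) % suc m            ≡⟨ cong (λ r → (r + 1) % suc m) toℕ-v ⟩
        ((i + 1) % suc m + 1) % suc m  ≡⟨ [m%n+o]%n≡[m+o]%n (i + 1) 1 (suc m) ⟩
        (i + 1 + 1) % suc m            ≡⟨ %-congˡ (+-assoc i 1 1) ⟩
        (i + 2) % suc m                ∎)

  periodicFair⇒isFair : PeriodicFair (suc m) S k → IsFair (cycleAdj (suc m)) S k
  periodicFair⇒isFair (g , per , labels , pathFair) = f , perm , fair
    where
    f : Fin (suc m) → ℕ
    f v = g (toℕ v)
    perm : map f (allFin (suc m)) ↭ S
    perm = ↭-trans (↭-reflexive (trans (map-tabulate id f) (tabulate-toℕ f g (λ _ → refl)))) labels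
    fair : ∀ v → nbrSum (cycleAdj (suc m)) f v ≡ k
    fair v = begin
      nbrSum (cycleAdj (suc m)) f v             ≡⟨ nbrSum-cycle m 2≤m f v ⟩
      f (cycle-pred m v) + f (cycle-succ m v)   ≡⟨ cong₂ (λ x y → g x + g y) (toℕ-mod (x + m) (suc m)) (toℕ-mod (x + 1) (suc m)) ⟩
      g ((x + m) % suc m) + g ((x + 1) % suc m) ≡⟨ cong₂ _+_ (periodic⇒g[i%p]≡g[i] per (x + m)) (periodic⇒g[i%p]≡g[i] per (x + 1)) ⟩
      g (x + m) + g (x + 1)                     ≡⟨ cong (g (x + m) +_) (per (x + 1)) ⟨
      g (x + m) + g (x + 1 + suc m)             ≡⟨ cong (λ j → g (x + m) + g j) x+1+n≡x+m+2 ⟩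
      g (x + m) + g (x + m + 2)                 ≡⟨ pathFair (x + m) ⟩
      k                                         ∎
      where
      x = toℕ v
      x+1+n≡x+m+2 : x + 1 + suc m ≡ x + m + 2
      x+1+n≡x+m+2 = trans (+-assoc x 1 (suc m)) (trans (cong (x +_) (+-comm 2 m)) (sym (+-assoc x m 2)))

  isFair⇔periodicFair : IsFair (cycleAdj (suc m)) S k ⇔ PeriodicFair (suc m) S k
  isFair⇔periodicFair = mk⇔ isFair⇒periodicFair periodicFair⇒isFair

periodic-4-labels : ∀ {g : ℕ → ℕ} → Periodic g 4 → ∀ q →
  applyUpTo g (q * 4) ↭ replicate q (g 0) ++ replicate q (g 1) ++ replicate q (g 2) ++ replicate q (g 3)
periodic-4-labels {g} per q = ↭-trans (↭-reflexive (applyUpTo-periodic per q)) (↭-trans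
  (concat-replicate-↭ q (applyUpTo g 4))
  (↭-reflexive (cong (λ t → replicate q (g 0) ++ replicate q (g 1) ++ replicate q (g 2) ++ t) (++-identityʳ _))))

blocks : ℕ → ℕ → ℕ → ℕ → List ℕ
blocks q a b k = replicate q a ++ replicate q b ++ replicate q (k ∸ a) ++ replicate q (k ∸ b)

periodicFair-4∣ : ∀ {n} .{{_ : NonZero n}} {S} → All (0 <_) S → ∀ k → n % 4 ≡ 0 →
  PeriodicFair n S k ⇔ ∃₂ λ a b → a < k × b < k × S ↭ blocks (n / 4) a b k
periodicFair-4∣ {n} {S} S-pos k n%4≡0 = mk⇔ to from
  where
  q = n / 4
  n≡q*4 : n ≡ q * 4
  n≡q*4 = trans (m≡m%n+[m/n]*n n 4) (cong (_+ q * 4) n%4≡0)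
  to : PeriodicFair n S k → ∃₂ λ a b → a < k × b < k × S ↭ blocks q a b k
  to (g , per , labels , fair) = g 0 , g 1 , pathFair-< g fair 0 (pos 2) , pathFair-< g fair 1 (pos 3) , S↭
    where
    pos : ∀ i → 0 < g i
    pos = periodic-All per (All-resp-↭ (↭-sym labels) S-pos)
    S↭ : S ↭ blocks q (g 0) (g 1) k
    S↭ = ↭-trans (↭-sym labels) (↭-trans (↭-reflexive (cong (applyUpTo g) n≡q*4)) (↭-trans
      (periodic-4-labels (pathFair-periodic g fair) q)
      (↭-reflexive (cong₂ (λ x y → replicate q (g 0) ++ replicate q (g 1) ++ replicate q x ++ replicate q y)
        (pathFair-opposite g fair 0) (pathFair-opposite g fair 1)))))
  from : (∃₂ λ a b → a < k × b < k × S ↭ blocks q a b k) → PeriodicFair n S k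
  from (a , b , a<k , b<k , S↭) = alternating a b k ,
    periodic-∣ (alternating-periodic a b k) (divides q n≡q*4) ,
    ↭-trans (↭-reflexive (cong (applyUpTo (alternating a b k)) n≡q*4))
      (↭-trans (periodic-4-labels (alternating-periodic a b k) q) (↭-sym S↭)) ,
    alternating-pathFair (<⇒≤ a<k) (<⇒≤ b<k)

periodicFair-4∤ : ∀ {n S k} → n % 4 ≢ 0 → PeriodicFair n S k ⇔ ∃ λ c → c + c ≡ k × S ↭ replicate n c
periodicFair-4∤ {n} {S} {k} n%4≢0 = mk⇔ to from
  where
  to : PeriodicFair n S k → ∃ λ c → c + c ≡ k × S ↭ replicate n c
  to (g , per , labels , fair) = g 0 , pathFair-double g fair per₂ 0 ,
    ↭-trans (↭-sym labels) (↭-reflexive (applyUpTo-const (pathFair-constant g fair per₂) n))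
    where
    per₂ : Periodic g 2
    per₂ = periodic-2 (pathFair-periodic g fair) per n%4≢0
  from : (∃ λ c → c + c ≡ k × S ↭ replicate n c) → PeriodicFair n S k
  from (c , c+c≡k , S↭) = (λ _ → c) , (λ _ → refl) ,
    ↭-trans (↭-reflexive (applyUpTo-const (λ _ → refl) n)) (↭-sym S↭) , (λ _ → c+c≡k)

lemma3 : (n : ℕ) → 3 ≤ n → (S : List ℕ) → length S ≡ n → All (0 <_) S →
    (k : ℕ) → 0 < k →
    ((n % 4 ≡ 0) →
      (IsFair (cycleAdj n) S k ⇔
        ∃₂ λ a b → a < k × b < k ×
          (S ↭ (replicate (n / 4) a ++ replicate (n / 4) b
                ++ replicate (n / 4) (k ∸ a) ++ replicate (n / 4) (k ∸ b)))))
    ×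
    ((n % 4 ≢ 0) →
      (IsFair (cycleAdj n) S k ⇔
        ∃ λ c → c + c ≡ k × S ↭ replicate n c))
lemma3 (suc m) (s≤s 2≤m) S _ S-pos k _ =
    (λ n%4≡0 → ⇔-trans (isFair⇔periodicFair 2≤m) (periodicFair-4∣ S-pos k n%4≡0))
  , (λ n%4≢0 → ⇔-trans (isFair⇔periodicFair 2≤m) (periodicFair-4∤ n%4≢0))
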